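{- Let $k\ge1$ and $j\ge 1$. (1) For $2\le s\le k$ and $m\ge1$, or for $s=1$ and $m=1$: if $\mathcal{BL}_k(k(m-1)+s,j)$ is nonempty then $m\ge j$. (2) For $1\le s\le k$ and $m\ge1$: if $\mathcal{BL}_k(k(m-1)+s,\overline{j})$ is nonempty then $s=1$ and $m\ge j$. (3) For $m\ge2$: if $\mathcal{BL}_k(k(m-1)+1,j)$ is nonempty then $m>j$.
   Context: Overpartitions here are non-increasing sequences of positive integers in which the last occurrence of each distinct part value may be overlined; a part $t$ or $\overline t$ has size $t$, written $|\cdot|=t$. An $L_k$-overpartition is an overpartition $\pi=(\pi_1,\ldots,\pi_\ell)$ such that whenever $\pi_i$ is overlined, $\ell-i\equiv 0\pmod k$. For $m\ge1$, $\mathcal{BL}_k(m)$ is the set of $L_k$-overpartitions $\lambda=(\lambda_1,\ldots,\lambda_m)$ with exactly $m$ parts such that $\lambda_m=\overline1$ or $1$, and for $1\le i<m$, $|\lambda_i|\le|\lambda_{i+1}|+1$, with strict inequality if $\lambda_i$ is non-overlined. For $m,j\ge1$, $\mathcal{BL}_k(m,j)$ (resp. $\mathcal{BL}_k(m,\overline j)$) is the set of overpartitions in $\mathcal{BL}_k(m)$ whose largest part is $j$ (resp. $\overline j$). -}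

module Defs where

open import Data.Nat using (ℕ; zero; suc; _+_; _*_; _∸_; _≤_; _<_)
open import Data.Nat.Divisibility using (_∣_)
open import Data.Bool using (Bool; true; false)
open import Data.Product using (_×_; _,_; proj₁; proj₂; ∃)
open import Relation.Binary.PropositionalEquality using (_≡_)

-- A part: (size , overlined?)
Part : Set
Part = ℕ × Bool

size : Part → ℕ
size = proj₁

ovl : Part → Bool
ovl = proj₂

-- A sequence of parts π₁ , … , π_m is given as a function π : ℕ → Part;
-- only the values at positions 1..m are relevant (1-indexed as in the paper).

IsOverpartition : ℕ → (ℕ → Part) → Set
IsOverpartition m π =
  (∀ i → 1 ≤ i → i ≤ m → 1 ≤ size (π i)) ×
  (∀ i → 1 ≤ i → i < m → size (π (suc i)) ≤ size (π i)) ×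
  (∀ i → 1 ≤ i → i < m → ovl (π i) ≡ true → size (π (suc i)) < size (π i))

IsLk : ℕ → ℕ → (ℕ → Part) → Set
IsLk k m π = ∀ i → 1 ≤ i → i ≤ m → ovl (π i) ≡ true → k ∣ (m ∸ i)

InBL : ℕ → ℕ → (ℕ → Part) → Set
InBL k m λ′ =
  1 ≤ m × IsOverpartition m λ′ × IsLk k m λ′ × size (λ′ m) ≡ 1 ×
  (∀ i → 1 ≤ i → i < m →
     size (λ′ i) ≤ size (λ′ (suc i)) + 1 ×
     (ovl (λ′ i) ≡ false → size (λ′ i) < size (λ′ (suc i)) + 1))

InBLj : ℕ → ℕ → ℕ → (ℕ → Part) → Set
InBLj k m j λ′ = InBL k m λ′ × λ′ 1 ≡ (j , false)

InBLbar : ℕ → ℕ → ℕ → (ℕ → Part) → Set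
InBLbar k m j λ′ = InBL k m λ′ × λ′ 1 ≡ (j , true)

BLNonempty : ℕ → ℕ → ℕ → Set
BLNonempty k m j = ∃ λ λ′ → InBLj k m j λ′

BLbarNonempty : ℕ → ℕ → ℕ → Set
BLbarNonempty k m j = ∃ λ λ′ → InBLbar k m j λ′

{-# OPTIONS --safe #-}
-- Reading λ ∈ BL_k(n) from its last part λ_n = 1 back to λ₁, the size stays
-- the same across a non-overlined part and goes up by exactly one across an
-- overlined part, and an overlined λ_i needs k ∣ n − i.  So d positions before
-- the end the size is at most 1 + ⌊d/k⌋, which for n = k(m−1) + s bounds λ₁ by m.
-- If λ₁ is overlined, then k ∣ n − 1 = k(m−1) + s − 1 forces s = 1; if it is
-- not, then λ₂ = λ₁ and one more position is lost, which gives the strict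
-- bound of (3).
module Submission where

open import Defs
open import Data.Nat using (ℕ; zero; suc; _+_; _*_; _∸_; _≤_; _<_; z≤n; s≤s)
open import Data.Nat.Properties
open import Data.Nat.Divisibility using (_∣_; divides; ∣m+n∣m⇒∣n; m∣m*n; >⇒∤)
open import Data.Bool using (true; false)
open import Data.Product using (_×_; _,_; proj₁; proj₂)
open import Data.Sum using (_⊎_; inj₁; inj₂)
open import Data.Empty using (⊥-elim)
open import Relation.Binary.PropositionalEquality
  using (_≡_; refl; sym; trans; cong; subst)

k*a≤k*b+r⇒a≤b : ∀ {k a b r} → r < k → k * a ≤ k * b + r → a ≤ b
k*a≤k*b+r⇒a≤b {k} {a} {b} {r} r<k ka≤kb+r = m<1+n⇒m≤n (*-cancelˡ-< k a (suc b) (begin-strict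
  k * a      ≤⟨ ka≤kb+r ⟩
  k * b + r  <⟨ +-monoʳ-< (k * b) r<k ⟩
  k * b + k  ≡⟨ +-comm (k * b) k ⟩
  k + k * b  ≡⟨ *-suc k b ⟨
  k * suc b  ∎))
  where open ≤-Reasoning

k∣n⇒k*a<k+n⇒k*a≤n : ∀ {k a n} → k ∣ n → k * a < k + n → k * a ≤ n
k∣n⇒k*a<k+n⇒k*a≤n {k} {a} (divides q refl) k*a<k+q*k = begin
  k * a  ≤⟨ *-monoʳ-≤ k (m<1+n⇒m≤n (*-cancelˡ-< k a (suc q) k*a<k*[1+q])) ⟩
  k * q  ≡⟨ *-comm k q ⟩
  q * k  ∎
  where
  open ≤-Reasoning
  k*a<k*[1+q] : k * a < k * suc q
  k*a<k*[1+q] = begin-strict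
    k * a      <⟨ k*a<k+q*k ⟩
    k + q * k  ≡⟨ cong (k +_) (*-comm q k) ⟩
    k + k * q  ≡⟨ *-suc k q ⟨
    k * suc q  ∎

plain-size≡ : ∀ {k n λ′ i} → InBL k n λ′ → 1 ≤ i → i < n → ovl (λ′ i) ≡ false →
              size (λ′ i) ≡ size (λ′ (suc i))
plain-size≡ {λ′ = λ′} {i} (_ , (_ , noninc , _) , _ , _ , step) 1≤i i<n plain =
  ≤-antisym (m<1+n⇒m≤n (subst (size (λ′ i) <_) (+-comm _ 1) (proj₂ (step i 1≤i i<n) plain)))
            (noninc i 1≤i i<n)

overlined-size≡ : ∀ {k n λ′ i} → InBL k n λ′ → 1 ≤ i → i < n → ovl (λ′ i) ≡ true →
                  size (λ′ i) ≡ suc (size (λ′ (suc i)))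
overlined-size≡ {λ′ = λ′} {i} (_ , (_ , _ , overlined-strict) , _ , _ , step) 1≤i i<n overlined =
  ≤-antisym (subst (size (λ′ i) ≤_) (+-comm _ 1) (proj₁ (step i 1≤i i<n)))
            (overlined-strict i 1≤i i<n overlined)

overlined⇒k∣distance : ∀ {k n λ′ i d} → InBL k n λ′ → 1 ≤ i → i + d ≡ n →
                       ovl (λ′ i) ≡ true → k ∣ d
overlined⇒k∣distance {k} {i = i} {d} (_ , _ , lk , _) 1≤i refl overlined =
  subst (k ∣_) (m+n∸m≡n i d) (lk i 1≤i (m≤m+n i d) overlined)

size-bound-step : ∀ {k n λ′ i d} → InBL k n λ′ → 1 ≤ i → i + suc d ≡ n →
                  k * size (λ′ (suc i)) ≤ k + d → k * size (λ′ i) ≤ k + suc d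
size-bound-step {k} {λ′ = λ′} {i} {d} bl 1≤i refl ih with ovl (λ′ i) in o
... | false = begin
  k * size (λ′ i)        ≡⟨ cong (k *_) (plain-size≡ bl 1≤i (m<m+n i (s≤s z≤n)) o) ⟩
  k * size (λ′ (suc i))  ≤⟨ ih ⟩
  k + d                  ≤⟨ +-monoʳ-≤ k (n≤1+n d) ⟩
  k + suc d              ∎
  where open ≤-Reasoning
... | true = begin
  k * size (λ′ i)              ≡⟨ cong (k *_) (overlined-size≡ bl 1≤i (m<m+n i (s≤s z≤n)) o) ⟩
  k * suc (size (λ′ (suc i)))  ≡⟨ *-suc k _ ⟩
  k + k * size (λ′ (suc i))    ≤⟨ +-monoʳ-≤ k (k∣n⇒k*a<k+n⇒k*a≤n (overlined⇒k∣distance bl 1≤i refl o)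
                                                 (≤-<-trans ih (+-monoʳ-< k (n<1+n d)))) ⟩
  k + suc d                    ∎
  where open ≤-Reasoning

size-bound : ∀ {k n λ′} → InBL k n λ′ → ∀ d {i} → 1 ≤ i → i + d ≡ n →
             k * size (λ′ i) ≤ k + d
size-bound {k} {λ′ = λ′} (_ , _ , _ , last , _) zero {i} _ refl = begin
  k * size (λ′ i)        ≡⟨ cong (λ p → k * size (λ′ p)) (+-identityʳ i) ⟨
  k * size (λ′ (i + 0))  ≡⟨ cong (k *_) last ⟩
  k * 1                  ≡⟨ *-identityʳ k ⟩
  k                      ≡⟨ +-identityʳ k ⟨
  k + 0                  ∎
  where open ≤-Reasoning
size-bound bl (suc d) {i} 1≤i i+[1+d]≡n =
  size-bound-step bl 1≤i i+[1+d]≡n (size-bound bl d (s≤s z≤n) (trans (sym (+-suc i d)) i+[1+d]≡n))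

largest-part≤ : ∀ {k m r λ′} → r < k → InBL k (k * m + suc r) λ′ → size (λ′ 1) ≤ suc m
largest-part≤ {k} {m} {r} {λ′} r<k bl = k*a≤k*b+r⇒a≤b r<k (begin
  k * size (λ′ 1)  ≤⟨ size-bound bl (k * m + r) ≤-refl (sym (+-suc (k * m) r)) ⟩
  k + (k * m + r)  ≡⟨ +-assoc k (k * m) r ⟨
  k + k * m + r    ≡⟨ cong (_+ r) (*-suc k m) ⟨
  k * suc m + r    ∎)
  where open ≤-Reasoning

overlined-largest-part⇒r≡0 : ∀ {k m r λ′} → r < k → InBL k (k * m + suc r) λ′ →
                             ovl (λ′ 1) ≡ true → r ≡ 0
overlined-largest-part⇒r≡0 {r = zero} _ _ _ = refl
overlined-largest-part⇒r≡0 {k} {m} {suc r} r<k bl overlined = ⊥-elim (>⇒∤ r<k k∣r)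
  where
  k∣r : k ∣ suc r
  k∣r = ∣m+n∣m⇒∣n (overlined⇒k∣distance bl ≤-refl (sym (+-suc (k * m) (suc r))) overlined)
                  (m∣m*n m)

-- For k = suc k′ the product k * suc m reduces to suc d, so λ₂ sits d positions from the end.
plain-largest-part< : ∀ {k m λ′} → 1 ≤ k → InBL k (k * suc m + 1) λ′ →
                      ovl (λ′ 1) ≡ false → size (λ′ 1) < suc (suc m)
plain-largest-part< {suc k′} {m} {λ′} _ bl plain = *-cancelˡ-< k _ _ (begin-strict
  k * size (λ′ 1)  ≡⟨ cong (k *_) (plain-size≡ bl ≤-refl (s≤s (m≤n+m 1 d)) plain) ⟩
  k * size (λ′ 2)  ≤⟨ size-bound bl d (s≤s z≤n) (+-comm 1 (suc d)) ⟩
  k + d            <⟨ +-monoʳ-< k (n<1+n d) ⟩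
  k + k * suc m    ≡⟨ *-suc k (suc m) ⟨
  k * suc (suc m)  ∎)
  where
  open ≤-Reasoning
  k d : ℕ
  k = suc k′
  d = m + k′ * suc m

proposition3p3 : (k j : ℕ) → 1 ≤ k → 1 ≤ j →
    ((s m : ℕ) → ((2 ≤ s × s ≤ k × 1 ≤ m) ⊎ (s ≡ 1 × m ≡ 1)) →
       BLNonempty k (k * (m ∸ 1) + s) j → j ≤ m)
    × ((s m : ℕ) → 1 ≤ s → s ≤ k → 1 ≤ m →
       BLbarNonempty k (k * (m ∸ 1) + s) j → s ≡ 1 × j ≤ m)
    × ((m : ℕ) → 2 ≤ m →
       BLNonempty k (k * (m ∸ 1) + 1) j → j < m)
proposition3p3 k j 1≤k _ = part₁ , part₂ , part₃
  where
  part₁ : (s m : ℕ) → ((2 ≤ s × s ≤ k × 1 ≤ m) ⊎ (s ≡ 1 × m ≡ 1)) →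
          BLNonempty k (k * (m ∸ 1) + s) j → j ≤ m
  part₁ (suc r) (suc m) (inj₁ (_ , s≤k , _)) (_ , bl , λ₁≡j) =
    subst (_≤ suc m) (cong size λ₁≡j) (largest-part≤ s≤k bl)
  part₁ 1 1 (inj₂ (refl , refl)) (_ , bl , λ₁≡j) =
    subst (_≤ 1) (cong size λ₁≡j) (largest-part≤ 1≤k bl)

  part₂ : (s m : ℕ) → 1 ≤ s → s ≤ k → 1 ≤ m →
          BLbarNonempty k (k * (m ∸ 1) + s) j → s ≡ 1 × j ≤ m
  part₂ (suc r) (suc m) _ s≤k _ (_ , bl , λ₁≡j̄) =
    cong suc (overlined-largest-part⇒r≡0 s≤k bl (cong ovl λ₁≡j̄)) ,
    subst (_≤ suc m) (cong size λ₁≡j̄) (largest-part≤ s≤k bl)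

  part₃ : (m : ℕ) → 2 ≤ m → BLNonempty k (k * (m ∸ 1) + 1) j → j < m
  part₃ (suc (suc m)) (s≤s (s≤s z≤n)) (_ , bl , λ₁≡j) =
    subst (_< suc (suc m)) (cong size λ₁≡j) (plain-largest-part< 1≤k bl (cong ovl λ₁≡j))
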